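{- Let $h\ge0$ and let $\rho,\rho'$ be traces of $K$ with $\mathcal S(\rho)=\mathcal S(\rho')$. Then for all $r\in\mathsf{spec}$ and all traces $\rho_L,\rho_R$ of $K$ such that $\rho_L\star\rho$ and $\rho\star\rho_R$ are defined: (1) $\mu(\rho)\in\mathcal L(r)$ iff $\mu(\rho')\in\mathcal L(r)$; (2) $\mathcal S(\rho_L\star\rho)=\mathcal S(\rho_L\star\rho')$; (3) $\mathcal S(\rho\star\rho_R)=\mathcal S(\rho'\star\rho_R)$.
   Context: $K=(AP,S,R,\mu,s_0)$ is a Kripke structure over a finite set $AP$ ($R\subseteq S\times S$, $\mu:S\to 2^{AP}$). A trace is a nonempty finite word $\rho$ over $S$ with $(\rho(i),\rho(i+1))\in R$ for all $i<|\rho|$; $\rho(i,j)=\rho(i)\cdots\rho(j)$; $\mu(\rho)=\mu(\rho(1))\cdots\mu(\rho(|\rho|))$; if $\rho(|\rho|)=\rho'(1)$ then $\rho\star\rho'=\rho(1,|\rho|-1)\cdot\rho'$. $\mathsf{spec}=\{r_1,\dots,r_H\}$ is a finite set of regular expressions over $AP$ ($r::=\varepsilon\mid\phi\mid r\cup r\mid r\cdot r\mid r^*$, $\phi$ propositional over $AP$, denoting languages over $2^{AP}$). For each $\ell$, $\mathcal A_\ell=(2^{AP},Q_\ell,Q^0_\ell,\Delta_\ell,F_\ell)$ is the canonical complete NFA accepting $\mathcal L(r_\ell)$ (standard compositional construction), the $Q_\ell$ being pairwise disjoint. The summary of a trace $\rho$ is $\mathcal S(\rho)=(\rho(1),\Pi,\rho(|\rho|))$,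 where $\Pi$ is the set of pairs $(q,q')$ such that for some $\ell\in[1,H]$, $q,q'\in Q_\ell$ and there is a run of $\mathcal A_\ell$ from $q$ to $q'$ over $\mu(\rho)$. -}

module Defs where

open import Data.Nat using (ℕ)
open import Data.Fin using (Fin)
open import Data.Bool using (Bool; true; false)
open import Data.List using (List; []; _∷_; _++_)
open import Data.List.NonEmpty using (List⁺; _∷_; toList; head; last; _++⁺_)
import Data.List as L
open import Data.Product using (Σ; _×_; ∃)
open import Data.Sum using (_⊎_)
open import Relation.Nullary using (¬_)
open import Relation.Binary.PropositionalEquality using (_≡_)
open import Function.Bundles using (_⇔_)

-- Atomic propositions AP = Fin m; letters are elements of 2^AP

Letter : ℕ → Set
Letter m = Fin m → Bool

Word : ℕ → Set
Word m = List (Letter m)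

data PropF (m : ℕ) : Set where
  atom : Fin m → PropF m
  ⊤ᶠ   : PropF m
  ⊥ᶠ   : PropF m
  ¬ᶠ_  : PropF m → PropF m
  _∧ᶠ_ : PropF m → PropF m → PropF m
  _∨ᶠ_ : PropF m → PropF m → PropF m

evalF : ∀ {m} → Letter m → PropF m → Bool
evalF a (atom p) = a p
evalF a ⊤ᶠ = true
evalF a ⊥ᶠ = false
evalF a (¬ᶠ φ) with evalF a φ
... | true = false
... | false = true
evalF a (φ ∧ᶠ ψ) with evalF a φ
... | true = evalF a ψ
... | false = false
evalF a (φ ∨ᶠ ψ) with evalF a φ
... | true = true
... | false = evalF a ψ

data RegExp (m : ℕ) : Set where
  ε    : RegExp m
  prop : PropF m → RegExp m
  _∪_  : RegExp m → RegExp m → RegExp m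
  _·_  : RegExp m → RegExp m → RegExp m
  _*   : RegExp m → RegExp m

data _∈L_ {m : ℕ} : Word m → RegExp m → Set where
  in-ε    : [] ∈L ε
  in-prop : ∀ {a φ} → evalF a φ ≡ true → (a ∷ []) ∈L prop φ
  in-∪ˡ   : ∀ {w r s} → w ∈L r → w ∈L (r ∪ s)
  in-∪ʳ   : ∀ {w r s} → w ∈L s → w ∈L (r ∪ s)
  in-·    : ∀ {u v r s} → u ∈L r → v ∈L s → (u ++ v) ∈L (r · s)
  in-*0   : ∀ {r} → [] ∈L (r *)
  in-*    : ∀ {u v r} → u ∈L r → v ∈L (r *) → (u ++ v) ∈L (r *)

record NFA (m : ℕ) : Set₁ where
  field
    Q  : Set
    Q₀ : Q → Set
    Δ  : Q → Letter m → Q → Set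
    F  : Q → Set

data Run {m : ℕ} (A : NFA m) : NFA.Q A → Word m → NFA.Q A → Set where
  run-[] : ∀ {q} → Run A q [] q
  run-∷  : ∀ {q a w q₁ q'} → NFA.Δ A q a q₁ → Run A q₁ w q' → Run A q (a ∷ w) q'

Accepts : ∀ {m} → NFA m → Word m → Set
Accepts A w = Σ (NFA.Q A) λ q → Σ (NFA.Q A) λ q' → NFA.Q₀ A q × NFA.F A q' × Run A q w q'

Complete : ∀ {m} → NFA m → Set
Complete A = ∀ q a → Σ (NFA.Q A) λ q' → NFA.Δ A q a q'

record Kripke (m : ℕ) : Set₁ where
  field
    S  : Set
    R  : S → S → Set
    μ  : S → Letter m
    s₀ : S

module _ {m : ℕ} (K : Kripke m) where
  open Kripke K

  Path : S → List S → Set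
  Path s [] = Data.Unit.⊤ where import Data.Unit
  Path s (t ∷ ts) = R s t × Path t ts

  IsTrace : List⁺ S → Set
  IsTrace (s ∷ ss) = Path s ss

  μ* : List⁺ S → Word m
  μ* ρ = L.map μ (toList ρ)

initAux : ∀ {A : Set} → A → List A → List A
initAux x [] = []
initAux x (y ∷ ys) = x ∷ initAux y ys

init⁺ : ∀ {A : Set} → List⁺ A → List A
init⁺ (x ∷ xs) = initAux x xs

-- ρ ⋆ ρ' = ρ(1,|ρ|-1) · ρ'  (meaningful when last ρ ≡ head ρ')
_⋆_ : ∀ {A : Set} → List⁺ A → List⁺ A → List⁺ A
ρ ⋆ ρ' = init⁺ ρ ++⁺ ρ'

-- Summaries.  Π(ρ) is represented as a predicate on triples (ℓ, q, q')
-- with q, q' ∈ Q_ℓ (the Q_ℓ are pairwise disjoint, so this is the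
-- tagged form of the set of pairs).  Equality of summaries
-- S(ρ) = S(ρ') means equal first state, equal last state, and equal
-- sets Π (extensionally).

module _ {m H : ℕ} (K : Kripke m) (A : Fin H → NFA m) where
  open Kripke K

  Π : List⁺ S → (ℓ : Fin H) → NFA.Q (A ℓ) → NFA.Q (A ℓ) → Set
  Π ρ ℓ q q' = Run (A ℓ) q (μ* K ρ) q'

  SameSummary : List⁺ S → List⁺ S → Set
  SameSummary ρ ρ' =
    (head ρ ≡ head ρ') × (last ρ ≡ last ρ') ×
    (∀ ℓ q q' → Π ρ ℓ q q' ⇔ Π ρ' ℓ q q')

-- Runs over a concatenation factor through an intermediate state, so the
-- relations "some run of A_ℓ leads from q to q′ over w" coincide for u ++ v and
-- u′ ++ v′ once they coincide for u, u′ and for v, v′. Extending ρ and ρ′ on the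
-- same side therefore preserves the summary, and membership of μ(ρ) in L(r_ℓ)
-- is determined by these relations since A_ℓ accepts exactly L(r_ℓ).
module Submission where

open import Defs
open import Data.Nat using (ℕ)
open import Data.Fin using (Fin)
open import Data.List using (List; []; _∷_; _++_; map; initLast; _∷ʳ′_)
open import Data.List.Properties using (map-++)
open import Data.List.NonEmpty using (List⁺; _∷_; head; tail; last; toList; _++⁺_)
open import Data.Product using (∃; _×_; _,_)
open import Relation.Binary.PropositionalEquality
  using (_≡_; refl; sym; trans; cong; subst₂)
open import Function.Bundles using (_⇔_; mk⇔; Equivalence)

open Equivalence

module _ {X : Set} where

  last-∷ : (x y : X) (ys : List X) → last (x ∷ y ∷ ys) ≡ last (y ∷ ys)
  last-∷ x y ys with initLast ys
  ... | []        = refl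
  ... | _ ∷ʳ′ _ = refl

  toList-++⁺ : (xs : List X) (σ : List⁺ X) → toList (xs ++⁺ σ) ≡ xs ++ toList σ
  toList-++⁺ []       σ = refl
  toList-++⁺ (x ∷ xs) σ with xs ++⁺ σ | toList-++⁺ xs σ
  ... | _ ∷ _ | eq = cong (x ∷_) eq

  last-++⁺ : (xs : List X) (σ : List⁺ X) → last (xs ++⁺ σ) ≡ last σ
  last-++⁺ []       σ = refl
  last-++⁺ (x ∷ xs) σ with xs ++⁺ σ | last-++⁺ xs σ
  ... | y ∷ ys | eq = trans (last-∷ x y ys) eq

  initAux-++-∷ : (x : X) (xs : List X) (y : X) (ys : List X) → last (x ∷ xs) ≡ y →
                 initAux x xs ++ y ∷ ys ≡ x ∷ xs ++ ys
  initAux-++-∷ x []        y ys x≡y = cong (_∷ ys) (sym x≡y)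
  initAux-++-∷ x (x′ ∷ xs) y ys eq  =
    cong (x ∷_) (initAux-++-∷ x′ xs y ys (trans (sym (last-∷ x x′ xs)) eq))

  toList-⋆ : (ρ σ : List⁺ X) → last ρ ≡ head σ → toList (ρ ⋆ σ) ≡ toList ρ ++ tail σ
  toList-⋆ (x ∷ xs) (y ∷ ys) eq =
    trans (toList-++⁺ (initAux x xs) (y ∷ ys)) (initAux-++-∷ x xs y ys eq)

  head-⋆ : (ρ σ : List⁺ X) → last ρ ≡ head σ → head (ρ ⋆ σ) ≡ head ρ
  head-⋆ (x ∷ [])     (y ∷ ys) x≡y = sym x≡y
  head-⋆ (x ∷ x′ ∷ xs) σ       _   with initAux x′ xs ++⁺ σ
  ... | _ ∷ _ = refl

  last-⋆ : (ρ σ : List⁺ X) → last (ρ ⋆ σ) ≡ last σ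
  last-⋆ ρ σ = last-++⁺ (init⁺ ρ) σ

module _ {m : ℕ} (A : NFA m) where

  Run-++⁻ : ∀ {q q′} u v → Run A q (u ++ v) q′ → ∃ λ p → Run A q u p × Run A p v q′
  Run-++⁻ []      v r            = _ , run-[] , r
  Run-++⁻ (a ∷ u) v (run-∷ δ r) with Run-++⁻ u v r
  ... | p , r₁ , r₂ = p , run-∷ δ r₁ , r₂

  Run-++⁺ : ∀ {q p q′} u v → Run A q u p → Run A p v q′ → Run A q (u ++ v) q′
  Run-++⁺ []      v run-[]       r₂ = r₂
  Run-++⁺ (a ∷ u) v (run-∷ δ r₁) r₂ = run-∷ δ (Run-++⁺ u v r₁ r₂)

  _≈ᴿ_ : Word m → Word m → Set
  u ≈ᴿ v = ∀ q q′ → Run A q u q′ ⇔ Run A q v q′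

  ≈ᴿ-sym : ∀ {u v} → u ≈ᴿ v → v ≈ᴿ u
  ≈ᴿ-sym u≈v q q′ = mk⇔ (from (u≈v q q′)) (to (u≈v q q′))

  ≈ᴿ-refl : ∀ {u} → u ≈ᴿ u
  ≈ᴿ-refl q q′ = mk⇔ (λ r → r) (λ r → r)

  private
    ++-cong⇒ : ∀ {u u′ v v′} → u ≈ᴿ u′ → v ≈ᴿ v′ →
               ∀ {q q′} → Run A q (u ++ v) q′ → Run A q (u′ ++ v′) q′
    ++-cong⇒ {u} {u′} {v} {v′} u≈u′ v≈v′ r with Run-++⁻ u v r
    ... | _ , r₁ , r₂ = Run-++⁺ u′ v′ (to (u≈u′ _ _) r₁) (to (v≈v′ _ _) r₂)

  ≈ᴿ-++-cong : ∀ {u u′ v v′} → u ≈ᴿ u′ → v ≈ᴿ v′ → (u ++ v) ≈ᴿ (u′ ++ v′)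
  ≈ᴿ-++-cong u≈u′ v≈v′ q q′ =
    mk⇔ (++-cong⇒ u≈u′ v≈v′) (++-cong⇒ (≈ᴿ-sym u≈u′) (≈ᴿ-sym v≈v′))

  Accepts-resp-≈ᴿ : ∀ {u v} → u ≈ᴿ v → Accepts A u → Accepts A v
  Accepts-resp-≈ᴿ u≈v (q , q′ , q∈Q₀ , q′∈F , r) = q , q′ , q∈Q₀ , q′∈F , to (u≈v q q′) r

  ∈L-resp-≈ᴿ : ∀ {r u v} → (∀ w → Accepts A w ⇔ w ∈L r) → u ≈ᴿ v → u ∈L r ⇔ v ∈L r
  ∈L-resp-≈ᴿ {u = u} {v} A≡r u≈v = mk⇔
    (λ u∈r → to (A≡r v) (Accepts-resp-≈ᴿ u≈v (from (A≡r u) u∈r)))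
    (λ v∈r → to (A≡r u) (Accepts-resp-≈ᴿ (≈ᴿ-sym u≈v) (from (A≡r v) v∈r)))

module _ {m H : ℕ} (K : Kripke m) (A : Fin H → NFA m) where
  open Kripke K

  μ*-⋆ˡ : (σ ρ : List⁺ S) → μ* K (σ ⋆ ρ) ≡ map μ (init⁺ σ) ++ μ* K ρ
  μ*-⋆ˡ σ ρ = trans (cong (map μ) (toList-++⁺ (init⁺ σ) ρ)) (map-++ μ (init⁺ σ) (toList ρ))

  μ*-⋆ʳ : (ρ σ : List⁺ S) → last ρ ≡ head σ → μ* K (ρ ⋆ σ) ≡ μ* K ρ ++ map μ (tail σ)
  μ*-⋆ʳ ρ σ eq = trans (cong (map μ) (toList-⋆ ρ σ eq)) (map-++ μ (toList ρ) (tail σ))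

  SameSummary-∈L : ∀ {ρ ρ′} (spec : Fin H → RegExp m) →
                   (∀ ℓ w → Accepts (A ℓ) w ⇔ w ∈L spec ℓ) →
                   SameSummary K A ρ ρ′ → ∀ ℓ → μ* K ρ ∈L spec ℓ ⇔ μ* K ρ′ ∈L spec ℓ
  SameSummary-∈L spec A≡spec (_ , _ , ρ≈ρ′) ℓ = ∈L-resp-≈ᴿ (A ℓ) (A≡spec ℓ) (ρ≈ρ′ ℓ)

  SameSummary-⋆ˡ : ∀ {ρ ρ′} σ → last σ ≡ head ρ →
                   SameSummary K A ρ ρ′ → SameSummary K A (σ ⋆ ρ) (σ ⋆ ρ′)
  SameSummary-⋆ˡ {ρ} {ρ′} σ σ⇾ρ (head≡ , last≡ , ρ≈ρ′) =
      trans (head-⋆ σ ρ σ⇾ρ) (sym (head-⋆ σ ρ′ (trans σ⇾ρ head≡)))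
    , trans (last-⋆ σ ρ) (trans last≡ (sym (last-⋆ σ ρ′)))
    , λ ℓ → subst₂ (_≈ᴿ_ (A ℓ)) (sym (μ*-⋆ˡ σ ρ)) (sym (μ*-⋆ˡ σ ρ′))
              (≈ᴿ-++-cong (A ℓ) (≈ᴿ-refl (A ℓ)) (ρ≈ρ′ ℓ))

  SameSummary-⋆ʳ : ∀ {ρ ρ′} σ → last ρ ≡ head σ →
                   SameSummary K A ρ ρ′ → SameSummary K A (ρ ⋆ σ) (ρ′ ⋆ σ)
  SameSummary-⋆ʳ {ρ} {ρ′} σ ρ⇾σ (head≡ , last≡ , ρ≈ρ′) =
      trans (head-⋆ ρ σ ρ⇾σ) (trans head≡ (sym (head-⋆ ρ′ σ ρ′⇾σ)))
    , trans (last-⋆ ρ σ) (sym (last-⋆ ρ′ σ))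
    , λ ℓ → subst₂ (_≈ᴿ_ (A ℓ)) (sym (μ*-⋆ʳ ρ σ ρ⇾σ)) (sym (μ*-⋆ʳ ρ′ σ ρ′⇾σ))
              (≈ᴿ-++-cong (A ℓ) (ρ≈ρ′ ℓ) (≈ᴿ-refl (A ℓ)))
    where
    ρ′⇾σ : last ρ′ ≡ head σ
    ρ′⇾σ = trans (sym last≡) ρ⇾σ

proposition1 : (m : ℕ) (K : Kripke m) (H : ℕ) (spec : Fin H → RegExp m)
    (A : Fin H → NFA m) →
    (∀ ℓ → Complete (A ℓ)) →
    (∀ ℓ w → Accepts (A ℓ) w ⇔ w ∈L spec ℓ) →
    (h : ℕ) →
    (ρ ρ' : List⁺ (Kripke.S K)) → IsTrace K ρ → IsTrace K ρ' →
    SameSummary K A ρ ρ' →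
    ∀ ℓ (ρL ρR : List⁺ (Kripke.S K)) → IsTrace K ρL → IsTrace K ρR →
    last ρL ≡ head ρ → last ρ ≡ head ρR →
    ((μ* K ρ ∈L spec ℓ) ⇔ (μ* K ρ' ∈L spec ℓ)) ×
    SameSummary K A (ρL ⋆ ρ) (ρL ⋆ ρ') ×
    SameSummary K A (ρ ⋆ ρR) (ρ' ⋆ ρR)
proposition1 m K H spec A _ A≡spec _ ρ ρ′ _ _ same ℓ ρL ρR _ _ ρL⇾ρ ρ⇾ρR =
    SameSummary-∈L K A spec A≡spec same ℓ
  , SameSummary-⋆ˡ K A ρL ρL⇾ρ same
  , SameSummary-⋆ʳ K A ρR ρ⇾ρR same
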